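{- Let $d$ be either $0$ or a positive square-free integer, $K=\mathbb{Q}(\sqrt{ -d})$, $R$ the ring of integers of $K$. For every $n\geq1$, the finite graphs $\Gamma_{1,n}$ and $\Gamma^{un}_{2,n}$ are perfect graphs.
   Context: A graph is perfect if every induced subgraph has chromatic number equal to its clique number. The zero-divisor graph $\Gamma(M_2(R))$ is the directed graph whose vertices are the nonzero (left or right) zero-divisors of $M_2(R)$, with an edge $v_1\to v_2$ between distinct vertices iff $v_1v_2=0$. For an integer $N\geq1$ and $t\in R$, let $S_{tc,1,t,N}=\{\lambda\begin{bmatrix}1&t\\t^2&t^3\end{bmatrix}:\lambda\in\mathbb{Z},\,1\leq|\lambda|\leq N\}$ and $S_{tc,2,N}=\{\begin{bmatrix}0&0\\0&\lambda\end{bmatrix}:\lambda\in\mathbb{Z},\,1\leq|\lambda|\leq N\}$. Let $\Gamma_{1,N}$ be the induced subgraph of $\Gamma(M_2(R))$ on $S_{tc,1,0,N}\cup S_{tc,2,N}$, regarded as an undirected graph. Let $U=\{\pm1\}$ if $d\neq1,3$, $U=\{\pm1,\pm i\}$ if $d=1$ ($i=\sqrt{ -1}$), $U=\{\pm1,\pm\omega,\pm\omega^2\}$ if $d=3$ ($\omega$ a primitive third root of unity); let $\Gamma_{2,N}$ be the induced subgraph of $\Gamma(M_2(R))$ on $\bigcup_{j\in U}S_{tc,1,j,N}$, and $\Gamma^{un}_{2,N}$ its underlying undirected graph (distinct $v_1,v_2$ adjacent iff $v_1v_2=0$ or $v_2v_1=0$). -}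

module Defs where

open import Data.Nat as ℕ using (ℕ; zero; suc)
open import Data.Nat.Divisibility using (_∣_)
open import Data.Nat.DivMod using (_%_; _/_)
open import Data.Integer as ℤ using (ℤ; +_; -[1+_]; ∣_∣)
open import Data.Bool using (Bool; true; false; if_then_else_)
open import Data.Fin using (Fin)
open import Data.Product using (Σ; ∃; ∃-syntax; _×_; _,_)
open import Data.Sum using (_⊎_)
open import Relation.Binary.PropositionalEquality using (_≡_; _≢_)

SquareFree : ℕ → Set
SquareFree d = ∀ (m : ℕ) → (m ℕ.* m) ∣ d → m ≡ 1

-- The ring of integers R of K = ℚ(√-d), d = 0 or d positive square-free.
--   d = 0        : K = ℚ, R = ℤ.
--   d ≡ 3 mod 4  : R = ℤ[θ], θ = (1 + √-d)/2, θ² = θ - (d+1)/4.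
--   otherwise    : R = ℤ[θ], θ = √-d,          θ² = -d.
-- For d > 0 an element (a , b) represents a + bθ.

R : ℕ → Set
R zero    = ℤ
R (suc k) = ℤ × ℤ

-- θ² = p·θ + q
θ²-p : ℕ → ℤ
θ²-p d = if ℕ._≡ᵇ_ (d % 4) 3 then + 1 else + 0

θ²-q : ℕ → ℤ
θ²-q d = if ℕ._≡ᵇ_ (d % 4) 3 then ℤ.- (+ ((d ℕ.+ 1) / 4)) else ℤ.- (+ d)

infixl 6 _+R_
infixl 7 _*R_
infix 8 -R_

fromℤ : (d : ℕ) → ℤ → R d
fromℤ zero    n = n
fromℤ (suc k) n = (n , + 0)

_+R_ : {d : ℕ} → R d → R d → R d
_+R_ {zero}  x y = x ℤ.+ y
_+R_ {suc k} (a , b) (c , e) = (a ℤ.+ c , b ℤ.+ e)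

_*R_ : {d : ℕ} → R d → R d → R d
_*R_ {zero}  x y = x ℤ.* y
_*R_ {suc k} (a , b) (c , e) =
  ( a ℤ.* c ℤ.+ b ℤ.* e ℤ.* θ²-q (suc k)
  , a ℤ.* e ℤ.+ b ℤ.* c ℤ.+ b ℤ.* e ℤ.* θ²-p (suc k) )

-R_ : {d : ℕ} → R d → R d
-R_ {zero}  x = ℤ.- x
-R_ {suc k} (a , b) = (ℤ.- a , ℤ.- b)

0R 1R : {d : ℕ} → R d
0R {d} = fromℤ d (+ 0)
1R {d} = fromℤ d (+ 1)

-- i = √-1 (the element θ, meaningful when d = 1)
ιR : (d : ℕ) → R d
ιR zero    = + 0
ιR (suc k) = (+ 0 , + 1)

-- ω = θ - 1 = (-1 + √-3)/2, a primitive third root of unity (meaningful when d = 3)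
ωR : (d : ℕ) → R d
ωR zero    = + 0
ωR (suc k) = (ℤ.- (+ 1) , + 1)

InU : (d : ℕ) → R d → Set
InU d t =
  t ≡ 1R ⊎ t ≡ -R 1R
  ⊎ (d ≡ 1 × (t ≡ ιR d ⊎ t ≡ -R ιR d))
  ⊎ (d ≡ 3 × (t ≡ ωR d ⊎ t ≡ -R ωR d ⊎ t ≡ ωR d *R ωR d ⊎ t ≡ -R (ωR d *R ωR d)))

record M2 (d : ℕ) : Set where
  constructor mat
  field
    m11 m12 m21 m22 : R d
open M2 public

_·M_ : {d : ℕ} → M2 d → M2 d → M2 d
A ·M B = mat (m11 A *R m11 B +R m12 A *R m21 B) (m11 A *R m12 B +R m12 A *R m22 B)
             (m21 A *R m11 B +R m22 A *R m21 B) (m21 A *R m12 B +R m22 A *R m22 B)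

0M : {d : ℕ} → M2 d
0M = mat 0R 0R 0R 0R

scal : {d : ℕ} → R d → M2 d → M2 d
scal c A = mat (c *R m11 A) (c *R m12 A) (c *R m21 A) (c *R m22 A)

InS1 : (d : ℕ) → R d → ℕ → M2 d → Set
InS1 d t N M = ∃[ λ' ] (1 ℕ.≤ ∣ λ' ∣ × ∣ λ' ∣ ℕ.≤ N ×
  M ≡ scal (fromℤ d λ') (mat 1R t (t *R t) (t *R t *R t)))

InS2 : (d : ℕ) → ℕ → M2 d → Set
InS2 d N M = ∃[ λ' ] (1 ℕ.≤ ∣ λ' ∣ × ∣ λ' ∣ ℕ.≤ N × M ≡ mat 0R 0R 0R (fromℤ d λ'))

-- undirected adjacency in Γ(M₂(R)) (distinctness is imposed where used)
AdjUn : {d : ℕ} → M2 d → M2 d → Set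
AdjUn A B = A ·M B ≡ 0M ⊎ B ·M A ≡ 0M

VertΓ1 : (d N : ℕ) → M2 d → Set
VertΓ1 d N M = InS1 d 0R N M ⊎ InS2 d N M

VertΓ2 : (d N : ℕ) → M2 d → Set
VertΓ2 d N M = ∃[ t ] (InU d t × InS1 d t N M)

-- A (finite) graph is given by a vertex predicate Vert on a
-- type A and an adjacency relation Adj (applied to distinct vertices).
-- Induced subgraphs are selected by a Boolean predicate P.

module _ {A : Set} (Vert : A → Set) (Adj : A → A → Set) where

  InSub : (A → Bool) → A → Set
  InSub P a = Vert a × P a ≡ true

  Colorable : (A → Bool) → ℕ → Set
  Colorable P k = Σ ((a : A) → InSub P a → Fin k) λ c →
    ∀ a b (ha : InSub P a) (hb : InSub P b) → a ≢ b → Adj a b → c a ha ≢ c b hb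

  HasClique : (A → Bool) → ℕ → Set
  HasClique P k = Σ (Fin k → A) λ f →
    (∀ i → InSub P (f i)) × (∀ i j → f i ≡ f j → i ≡ j) × (∀ i j → i ≢ j → Adj (f i) (f j))

  ChromaticNumber : (A → Bool) → ℕ → Set
  ChromaticNumber P k = Colorable P k × (∀ j → Colorable P j → k ℕ.≤ j)

  CliqueNumber : (A → Bool) → ℕ → Set
  CliqueNumber P k = HasClique P k × (∀ j → HasClique P j → j ℕ.≤ k)

  Perfect : Set
  Perfect = ∀ (P : A → Bool) → ∃[ k ] (ChromaticNumber P k × CliqueNumber P k)

-- Scaling by nonzero integers neither creates nor destroys zero products, so inside each set
-- S_{tc,1,t,N} (resp. S_{tc,2,N}) either all or no pairs of vertices are adjacent, according to
-- whether the generator B t (resp. E₂₂) is adjacent to itself, and the same dichotomy holds between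
-- two such sets. Writing S_t for S_{tc,1,t,N}, + for disjoint union and ⋈ for join, Γ_{1,N} is
-- S_0 ⋈ S_{tc,2,N}, and Γ^{un}_{2,N} is S_1 ⋈ S_{-1} for d ≠ 1, 3, S_1 ⋈ (S_{-1} + S_i + S_{-i}) for
-- d = 1, and (S_1 ⋈ S_{-1}) + (S_ω ⋈ S_{-ω}) + (S_{ω²} ⋈ S_{-ω²}) for d = 3, where each S_u with
-- u ∈ {1, i, -i, ω, ω²} is edgeless and each S_{-u} with u ∈ {1, ω, ω²} is complete.
-- Graphs built from single vertices by disjoint unions and joins are perfect: every induced
-- subgraph has a colouring and a clique of the same size, obtained across a disjoint union by
-- keeping the larger of the two, and across a join by combining both.

module Submission where

open import Defs
open import Level using (0ℓ)
open import Data.Nat as ℕ using (ℕ; zero; suc; _≤_; _<_; _+_; z≤n; s≤s)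
import Data.Nat.Properties as ℕP
open import Data.Fin as Fin using (Fin; splitAt; inject≤)
open import Data.Fin.Properties using (inject≤-injective; injective⇒≤; splitAt-join; join-splitAt)
open import Data.Integer as ℤ using (ℤ; +_; -[1+_]; ∣_∣)
import Data.Integer.Properties as ℤP
open import Data.Integer.Tactic.RingSolver using (solve-∀)
open import Data.Product using (∃-syntax; _×_; _,_; proj₁; proj₂; swap; map₁)
open import Data.Sum as Sum using (_⊎_; inj₁; inj₂)
open import Data.Sum.Properties using (inj₁-injective; inj₂-injective)
open import Data.Empty using (⊥-elim)
open import Data.Bool using (Bool; true; false)
open import Function using (_∘_; _∘₂_)
open import Function.Definitions using (Injective)
open import Relation.Nullary using (¬_; yes; no)
open import Relation.Unary using (Pred; _∈_; ｛_｝; _⊆_; _≐_; _∪_; Empty)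
open import Relation.Unary.Properties using (≐-sym)
open import Relation.Binary.PropositionalEquality

join-injective : ∀ m n {s t : Fin m ⊎ Fin n} → Fin.join m n s ≡ Fin.join m n t → s ≡ t
join-injective m n {s} {t} e =
  trans (sym (splitAt-join m n s)) (trans (cong (splitAt m) e) (splitAt-join m n t))

splitAt-injective : ∀ m n {i j : Fin (m + n)} → splitAt m i ≡ splitAt m j → i ≡ j
splitAt-injective m n {i} {j} e =
  trans (sym (join-splitAt m n i)) (trans (cong (Fin.join m n) e) (join-splitAt m n j))

Range : {A : Set} → (ℤ → A) → ℕ → Pred A 0ℓ
Range f N x = ∃[ l ] (1 ≤ ∣ l ∣ × ∣ l ∣ ≤ N × x ≡ f l)

Ends : {A : Set} → (ℤ → A) → ℕ → Pred A 0ℓ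
Ends f N = ｛ f (+ suc N) ｝ ∪ ｛ f -[1+ N ] ｝

module _ {A : Set} {f : ℤ → A} where

  range-zero : Empty (Range f 0)
  range-zero _ (_ , 1≤l , l≤0 , _) = ℕP.<⇒≱ 1≤l l≤0

  range-suc : ∀ {N} → Range f (suc N) ≐ Range f N ∪ Ends f N
  range-suc {N} = split , join
    where
    abs≡suc : ∀ l → ∣ l ∣ ≡ suc N → + suc N ≡ l ⊎ -[1+ N ] ≡ l
    abs≡suc (+ _) refl = inj₁ refl
    abs≡suc -[1+ _ ] refl = inj₂ refl
    split : Range f (suc N) ⊆ Range f N ∪ Ends f N
    split (l , 1≤l , l≤1+N , refl) with ∣ l ∣ ℕ.≤? N
    ... | yes l≤N = inj₁ (l , 1≤l , l≤N , refl)
    ... | no l≰N  = inj₂ (Sum.map (cong f) (cong f) (abs≡suc l (ℕP.≤-antisym l≤1+N (ℕP.≰⇒> l≰N))))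
    join : Range f N ∪ Ends f N ⊆ Range f (suc N)
    join (inj₁ (l , 1≤l , l≤N , x≡fl)) = l , 1≤l , ℕP.m≤n⇒m≤1+n l≤N , x≡fl
    join (inj₂ (inj₁ refl)) = + suc N , s≤s z≤n , ℕP.≤-refl , refl
    join (inj₂ (inj₂ refl)) = -[1+ N ] , s≤s z≤n , ℕP.≤-refl , refl

module Graph {A : Set} (Adj : A → A → Set) where

  Between : (A → A → Set) → Pred A 0ℓ → Pred A 0ℓ → Set
  Between _~_ V W = ∀ x y → x ∈ V → y ∈ W → x ~ y

  between-∪ˡ : ∀ {_~_ V₁ V₂ W} → Between _~_ V₁ W → Between _~_ V₂ W → Between _~_ (V₁ ∪ V₂) W
  between-∪ˡ b₁ b₂ x y (inj₁ v) w = b₁ x y v w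
  between-∪ˡ b₁ b₂ x y (inj₂ v) w = b₂ x y v w

  between-∪ʳ : ∀ {_~_ V W₁ W₂} → Between _~_ V W₁ → Between _~_ V W₂ → Between _~_ V (W₁ ∪ W₂)
  between-∪ʳ b₁ b₂ x y v (inj₁ w) = b₁ x y v w
  between-∪ʳ b₁ b₂ x y v (inj₂ w) = b₂ x y v w

  Nonadjacent : A → A → Set
  Nonadjacent x y = ¬ Adj x y × ¬ Adj y x

  Anticomplete : Pred A 0ℓ → Pred A 0ℓ → Set
  Anticomplete = Between Nonadjacent

  anticomplete-∪ˡ : ∀ {V₁ V₂ W} → Anticomplete V₁ W → Anticomplete V₂ W → Anticomplete (V₁ ∪ V₂) W
  anticomplete-∪ˡ = between-∪ˡ {Nonadjacent}

  anticomplete-∪ʳ : ∀ {V W₁ W₂} → Anticomplete V W₁ → Anticomplete V W₂ → Anticomplete V (W₁ ∪ W₂)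
  anticomplete-∪ʳ = between-∪ʳ {Nonadjacent}

  anticomplete-sym : ∀ {V W} → Anticomplete V W → Anticomplete W V
  anticomplete-sym a y x w v = swap (a x y v w)

  DistinctAdjacent : A → A → Set
  DistinctAdjacent x y = x ≢ y × Adj x y × Adj y x

  Complete : Pred A 0ℓ → Pred A 0ℓ → Set
  Complete = Between DistinctAdjacent

  complete-∪ʳ : ∀ {V W₁ W₂} → Complete V W₁ → Complete V W₂ → Complete V (W₁ ∪ W₂)
  complete-∪ʳ = between-∪ʳ {DistinctAdjacent}

  Certificate : Pred A 0ℓ → (A → Bool) → ℕ → Set
  Certificate V P k = Colorable V Adj P k × HasClique V Adj P k

  Certified : Pred A 0ℓ → Set
  Certified V = ∀ P → ∃[ k ] Certificate V P k

  clique≤colours : ∀ {V P j k} → HasClique V Adj P j → Colorable V Adj P k → j ≤ k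
  clique≤colours (f , f∈P , f-injective , f-adjacent) (c , c-proper) = injective⇒≤ colour-injective
    where
    colour-injective : Injective _≡_ _≡_ (λ i → c (f i) (f∈P i))
    colour-injective {i} {j} same with i Fin.≟ j
    ... | yes i≡j = i≡j
    ... | no i≢j = ⊥-elim (c-proper _ _ (f∈P i) (f∈P j) (i≢j ∘ f-injective i j) (f-adjacent i j i≢j) same)

  certificate⇒numbers : ∀ {V P k} → Certificate V P k →
                        ChromaticNumber V Adj P k × CliqueNumber V Adj P k
  certificate⇒numbers (c , q) = (c , λ _ c′ → clique≤colours q c′) , (q , λ _ q′ → clique≤colours q′ c)

  certified⇒perfect : ∀ {V} → Certified V → Perfect V Adj
  certified⇒perfect cert P = let k , c = cert P in k , certificate⇒numbers c

  colouring-⊆ : ∀ {V W P k} → W ⊆ V → Colorable V Adj P k → Colorable W Adj P k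
  colouring-⊆ W⊆V (c , c-proper) =
    (λ a (w , p) → c a (W⊆V w , p)) , λ a b (v , p) (w , q) → c-proper a b (W⊆V v , p) (W⊆V w , q)

  clique-⊆ : ∀ {V W P k} → V ⊆ W → HasClique V Adj P k → HasClique W Adj P k
  clique-⊆ V⊆W (f , f∈P , f-injective , f-adjacent) =
    f , map₁ V⊆W ∘ f∈P , f-injective , f-adjacent

  certified-≐ : ∀ {V W} → V ≐ W → Certified V → Certified W
  certified-≐ {V} {W} (V⊆W , W⊆V) cert P =
    let k , c , q = cert P in k , colouring-⊆ {V} {W} {P} {k} W⊆V c , clique-⊆ {V} {W} {P} {k} V⊆W q

  certified-∅ : ∀ {V} → Empty V → Certified V
  certified-∅ empty P = 0 , ((λ a (v , _) → ⊥-elim (empty a v)) , λ a _ (v , _) → ⊥-elim (empty a v))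
                          , ((λ ()) , (λ ()) , (λ ()) , (λ ()))

  certified-｛｝ : ∀ a → Certified ｛ a ｝
  certified-｛｝ a P with P a in Pa
  ... | true  = 1 , ((λ _ _ → Fin.zero) , λ { _ _ (refl , _) (refl , _) a≢a _ _ → a≢a refl })
                  , ((λ _ → a) , (λ _ → refl , Pa) , (λ { Fin.zero Fin.zero _ → refl })
                    , λ { Fin.zero Fin.zero 0≢0 → ⊥-elim (0≢0 refl) })
  ... | false = 0 , ((λ { _ (refl , Pa′) → ⊥-elim (true≢false (trans (sym Pa′) Pa)) })
                     , λ { _ _ (refl , Pa′) → ⊥-elim (true≢false (trans (sym Pa′) Pa)) })
                  , ((λ ()) , (λ ()) , (λ ()) , (λ ()))
    where
    true≢false : true ≢ false
    true≢false ()

  colouring-∪ : ∀ {V W P k₁ k₂} → Anticomplete V W → k₁ ≤ k₂ →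
                Colorable V Adj P k₁ → Colorable W Adj P k₂ → Colorable (V ∪ W) Adj P k₂
  colouring-∪ {V} {W} {P} {k₁} {k₂} anti k₁≤k₂ (c₁ , proper₁) (c₂ , proper₂) = c , proper
    where
    c : ∀ a → InSub (V ∪ W) Adj P a → Fin k₂
    c a (inj₁ v , p) = inject≤ (c₁ a (v , p)) k₁≤k₂
    c a (inj₂ w , p) = c₂ a (w , p)
    proper : ∀ a b sa sb → a ≢ b → Adj a b → c a sa ≢ c b sb
    proper a b (inj₁ v , p) (inj₁ v′ , p′) a≢b ab same =
      proper₁ a b (v , p) (v′ , p′) a≢b ab (inject≤-injective k₁≤k₂ k₁≤k₂ _ _ same)
    proper a b (inj₁ v , _) (inj₂ w , _) _ ab _ = proj₁ (anti a b v w) ab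
    proper a b (inj₂ w , _) (inj₁ v , _) _ ab _ = proj₂ (anti b a v w) ab
    proper a b (inj₂ w , p) (inj₂ w′ , p′) a≢b ab same = proper₂ a b (w , p) (w′ , p′) a≢b ab same

  certified-∪ : ∀ {V W} → Anticomplete V W → Certified V → Certified W → Certified (V ∪ W)
  certified-∪ {V} {W} anti certV certW P with certV P | certW P
  ... | k₁ , c₁ , q₁ | k₂ , c₂ , q₂ with ℕP.≤-total k₁ k₂
  ...   | inj₁ k₁≤k₂ = k₂ , colouring-∪ anti k₁≤k₂ c₁ c₂ , clique-⊆ {W} {V ∪ W} {P} {k₂} inj₂ q₂
  ...   | inj₂ k₂≤k₁ = k₁ , colouring-⊆ {W ∪ V} {V ∪ W} {P} {k₁} Sum.swap
                                (colouring-∪ (anticomplete-sym anti) k₂≤k₁ c₂ c₁)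
                          , clique-⊆ {V} {V ∪ W} {P} {k₁} inj₁ q₁

  colouring-join : ∀ {V W P k₁ k₂} →
                   Colorable V Adj P k₁ → Colorable W Adj P k₂ → Colorable (V ∪ W) Adj P (k₁ + k₂)
  colouring-join {V} {W} {P} {k₁} {k₂} (c₁ , proper₁) (c₂ , proper₂) =
    Fin.join k₁ k₂ ∘₂ palette , λ a b sa sb a≢b ab → proper a b sa sb a≢b ab ∘ join-injective k₁ k₂
    where
    palette : ∀ a → InSub (V ∪ W) Adj P a → Fin k₁ ⊎ Fin k₂
    palette a (inj₁ v , p) = inj₁ (c₁ a (v , p))
    palette a (inj₂ w , p) = inj₂ (c₂ a (w , p))
    proper : ∀ a b sa sb → a ≢ b → Adj a b → palette a sa ≢ palette b sb
    proper a b (inj₁ v , p) (inj₁ v′ , p′) a≢b ab = proper₁ a b (v , p) (v′ , p′) a≢b ab ∘ inj₁-injective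
    proper a b (inj₁ _ , _) (inj₂ _ , _) _ _ ()
    proper a b (inj₂ _ , _) (inj₁ _ , _) _ _ ()
    proper a b (inj₂ w , p) (inj₂ w′ , p′) a≢b ab = proper₂ a b (w , p) (w′ , p′) a≢b ab ∘ inj₂-injective

  clique-join : ∀ {V W P k₁ k₂} → Complete V W →
                HasClique V Adj P k₁ → HasClique W Adj P k₂ → HasClique (V ∪ W) Adj P (k₁ + k₂)
  clique-join {V} {W} {P} {k₁} {k₂} comp (f₁ , f₁∈P , f₁-injective , f₁-adjacent)
                                         (f₂ , f₂∈P , f₂-injective , f₂-adjacent) =
    f ∘ splitAt k₁ , f∈P ∘ splitAt k₁
    , (λ i j → splitAt-injective k₁ k₂ ∘ f-injective _ _)
    , (λ i j i≢j → f-adjacent _ _ (i≢j ∘ splitAt-injective k₁ k₂))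
    where
    f : Fin k₁ ⊎ Fin k₂ → A
    f = Sum.[ f₁ , f₂ ]
    f∈P : ∀ s → InSub (V ∪ W) Adj P (f s)
    f∈P (inj₁ i) = map₁ inj₁ (f₁∈P i)
    f∈P (inj₂ j) = map₁ inj₂ (f₂∈P j)
    across : ∀ i j → DistinctAdjacent (f₁ i) (f₂ j)
    across i j = comp _ _ (proj₁ (f₁∈P i)) (proj₁ (f₂∈P j))
    f-injective : ∀ s t → f s ≡ f t → s ≡ t
    f-injective (inj₁ i) (inj₁ i′) e = cong inj₁ (f₁-injective i i′ e)
    f-injective (inj₁ i) (inj₂ j)  e = ⊥-elim (proj₁ (across i j) e)
    f-injective (inj₂ j) (inj₁ i)  e = ⊥-elim (proj₁ (across i j) (sym e))
    f-injective (inj₂ j) (inj₂ j′) e = cong inj₂ (f₂-injective j j′ e)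
    f-adjacent : ∀ s t → s ≢ t → Adj (f s) (f t)
    f-adjacent (inj₁ i) (inj₁ i′) s≢t = f₁-adjacent i i′ (s≢t ∘ cong inj₁)
    f-adjacent (inj₁ i) (inj₂ j)  _   = proj₁ (proj₂ (across i j))
    f-adjacent (inj₂ j) (inj₁ i)  _   = proj₂ (proj₂ (across i j))
    f-adjacent (inj₂ j) (inj₂ j′) s≢t = f₂-adjacent j j′ (s≢t ∘ cong inj₂)

  certified-join : ∀ {V W} → Complete V W → Certified V → Certified W → Certified (V ∪ W)
  certified-join comp certV certW P =
    let k₁ , c₁ , q₁ = certV P ; k₂ , c₂ , q₂ = certW P
    in k₁ + k₂ , colouring-join c₁ c₂ , clique-join {P = P} comp q₁ q₂

  certified-range-edgeless : ∀ {f} → (∀ {l m} → 1 ≤ ∣ l ∣ → 1 ≤ ∣ m ∣ → ¬ Adj (f l) (f m)) →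
                             ∀ N → Certified (Range f N)
  certified-range-edgeless no-edge zero = certified-∅ range-zero
  certified-range-edgeless {f} no-edge (suc N) =
    certified-≐ (≐-sym range-suc)
      (certified-∪ (within (older ∘ inj₁) (older ∘ inj₂)) (certified-range-edgeless no-edge N)
        (certified-∪ (within (ends ∘ inj₁) (ends ∘ inj₂)) (certified-｛｝ _) (certified-｛｝ _)))
    where
    older = proj₂ range-suc
    ends : Ends f N ⊆ Range f (suc N)
    ends = older ∘ inj₂
    nonadjacent : Anticomplete (Range f (suc N)) (Range f (suc N))
    nonadjacent _ _ (_ , 1≤l , _ , refl) (_ , 1≤m , _ , refl) = no-edge 1≤l 1≤m , no-edge 1≤m 1≤l
    within : ∀ {V W} → V ⊆ Range f (suc N) → W ⊆ Range f (suc N) → Anticomplete V W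
    within V⊆ W⊆ x y v w = nonadjacent x y (V⊆ v) (W⊆ w)

  certified-range-complete : ∀ {f} → Injective _≡_ _≡_ f →
                             (∀ {l m} → 1 ≤ ∣ l ∣ → 1 ≤ ∣ m ∣ → Adj (f l) (f m)) →
                             ∀ N → Certified (Range f N)
  certified-range-complete f-injective edge zero = certified-∅ range-zero
  certified-range-complete {f} f-injective edge (suc N) =
    certified-≐ (≐-sym range-suc)
      (certified-join (within (older ∘ inj₁) (older ∘ inj₂) new≢old)
        (certified-range-complete f-injective edge N)
        (certified-join (within (ends ∘ inj₁) (ends ∘ inj₂) ends-distinct) (certified-｛｝ _) (certified-｛｝ _)))
    where
    older = proj₂ range-suc
    ends : Ends f N ⊆ Range f (suc N)
    ends = older ∘ inj₂
    adjacent : Between Adj (Range f (suc N)) (Range f (suc N))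
    adjacent _ _ (_ , 1≤l , _ , refl) (_ , 1≤m , _ , refl) = edge 1≤l 1≤m
    within : ∀ {V W} → V ⊆ Range f (suc N) → W ⊆ Range f (suc N) → Between _≢_ V W → Complete V W
    within V⊆ W⊆ distinct x y v w = distinct x y v w , adjacent x y (V⊆ v) (W⊆ w) , adjacent y x (W⊆ w) (V⊆ v)
    new≢old : Between _≢_ (Range f N) (Ends f N)
    new≢old _ _ (l , _ , l≤N , refl) (inj₁ refl) e = ℕP.n≮n N (subst (_≤ N) (cong ∣_∣ (f-injective e)) l≤N)
    new≢old _ _ (l , _ , l≤N , refl) (inj₂ refl) e = ℕP.n≮n N (subst (_≤ N) (cong ∣_∣ (f-injective e)) l≤N)
    ends-distinct : Between _≢_ ｛ f (+ suc N) ｝ ｛ f -[1+ N ] ｝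
    ends-distinct _ _ refl refl e with f-injective e
    ... | ()

Range-cong : ∀ {A : Set} {f g : ℤ → A} {N} → (∀ l → f l ≡ g l) → Range f N ≐ Range g N
Range-cong f≗g = (λ (l , 1≤l , l≤N , x≡fl) → l , 1≤l , l≤N , trans x≡fl (f≗g l))
               , (λ (l , 1≤l , l≤N , x≡gl) → l , 1≤l , l≤N , trans x≡gl (sym (f≗g l)))

infixr 8 _•_ _•M_ _⋆_

_•_ : {d : ℕ} → ℤ → R d → R d
_•_ {zero}  l x       = l ℤ.* x
_•_ {suc _} l (a , b) = l ℤ.* a , l ℤ.* b

fromℤ-*R : ∀ d l (x : R d) → fromℤ d l *R x ≡ l • x
fromℤ-*R zero    l x       = refl
fromℤ-*R (suc _) l (a , b) = cong₂ _,_ (ℤP.+-identityʳ _) (trans (ℤP.+-identityʳ _) (ℤP.+-identityʳ _))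

•-*R : ∀ {d} l m (x y : R d) → (l • x) *R (m • y) ≡ (l ℤ.* m) • (x *R y)
•-*R {zero}  l m x y = interchange l m x y
  where
  interchange : ∀ l m x y → (l ℤ.* x) ℤ.* (m ℤ.* y) ≡ (l ℤ.* m) ℤ.* (x ℤ.* y)
  interchange = solve-∀
•-*R {suc _} l m (a , b) (c , e) = cong₂ _,_ (constant-part l m a b c e _) (θ-part l m a b c e _)
  where
  constant-part : ∀ l m a b c e q →
    (l ℤ.* a) ℤ.* (m ℤ.* c) ℤ.+ (l ℤ.* b) ℤ.* (m ℤ.* e) ℤ.* q ≡ (l ℤ.* m) ℤ.* (a ℤ.* c ℤ.+ b ℤ.* e ℤ.* q)
  constant-part = solve-∀
  θ-part : ∀ l m a b c e p →
    (l ℤ.* a) ℤ.* (m ℤ.* e) ℤ.+ (l ℤ.* b) ℤ.* (m ℤ.* c) ℤ.+ (l ℤ.* b) ℤ.* (m ℤ.* e) ℤ.* p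
      ≡ (l ℤ.* m) ℤ.* (a ℤ.* e ℤ.+ b ℤ.* c ℤ.+ b ℤ.* e ℤ.* p)
  θ-part = solve-∀

•-distribˡ-+R : ∀ {d} l (x y : R d) → l • (x +R y) ≡ l • x +R l • y
•-distribˡ-+R {zero}  l x       y       = ℤP.*-distribˡ-+ l x y
•-distribˡ-+R {suc _} l (a , b) (c , e) = cong₂ _,_ (ℤP.*-distribˡ-+ l a c) (ℤP.*-distribˡ-+ l b e)

•-0R : ∀ {d} l → l • 0R {d} ≡ 0R
•-0R {zero}  l = ℤP.*-zeroʳ l
•-0R {suc _} l = cong₂ _,_ (ℤP.*-zeroʳ l) (ℤP.*-zeroʳ l)

•-1R : ∀ {d} l → l • 1R {d} ≡ fromℤ d l
•-1R {zero}  l = ℤP.*-identityʳ l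
•-1R {suc _} l = cong₂ _,_ (ℤP.*-identityʳ l) (ℤP.*-zeroʳ l)

•-cancelˡ : ∀ {d} l .{{_ : ℤ.NonZero l}} {x y : R d} → l • x ≡ l • y → x ≡ y
•-cancelˡ {zero}  l {x}     {y}     e = ℤP.*-cancelˡ-≡ l x y e
•-cancelˡ {suc _} l {a , b} {c , e} p =
  cong₂ _,_ (ℤP.*-cancelˡ-≡ l a c (cong proj₁ p)) (ℤP.*-cancelˡ-≡ l b e (cong proj₂ p))

fromℤ-injective : ∀ d {l m} → fromℤ d l ≡ fromℤ d m → l ≡ m
fromℤ-injective zero    e = e
fromℤ-injective (suc _) e = cong proj₁ e

•-1R-injective : ∀ {d l m} → l • 1R {d} ≡ m • 1R → l ≡ m
•-1R-injective {d} {l} {m} e = fromℤ-injective d (trans (sym (•-1R l)) (trans e (•-1R m)))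

mat-cong : ∀ {d} {a b c e a′ b′ c′ e′ : R d} →
           a ≡ a′ → b ≡ b′ → c ≡ c′ → e ≡ e′ → mat a b c e ≡ mat a′ b′ c′ e′
mat-cong refl refl refl refl = refl

_•M_ : {d : ℕ} → ℤ → M2 d → M2 d
l •M X = mat (l • m11 X) (l • m12 X) (l • m21 X) (l • m22 X)

•M-·M : ∀ {d} l m (X Y : M2 d) → (l •M X) ·M (m •M Y) ≡ (l ℤ.* m) •M (X ·M Y)
•M-·M {d} l m X Y = mat-cong (entry _ _ _ _) (entry _ _ _ _) (entry _ _ _ _) (entry _ _ _ _)
  where
  entry : ∀ (a b c e : R d) → (l • a) *R (m • b) +R (l • c) *R (m • e) ≡ (l ℤ.* m) • (a *R b +R c *R e)
  entry a b c e = begin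
    (l • a) *R (m • b) +R (l • c) *R (m • e)   ≡⟨ cong₂ _+R_ (•-*R l m a b) (•-*R l m c e) ⟩
    (l ℤ.* m) • (a *R b) +R (l ℤ.* m) • (c *R e) ≡⟨ •-distribˡ-+R (l ℤ.* m) _ _ ⟨
    (l ℤ.* m) • (a *R b +R c *R e)             ∎
    where open ≡-Reasoning

•M-cancelˡ : ∀ {d} l .{{_ : ℤ.NonZero l}} {X Y : M2 d} → l •M X ≡ l •M Y → X ≡ Y
•M-cancelˡ l e = mat-cong (•-cancelˡ l (cong m11 e)) (•-cancelˡ l (cong m12 e))
                          (•-cancelˡ l (cong m21 e)) (•-cancelˡ l (cong m22 e))

_⋆_ : {d : ℕ} → ℤ → M2 d → M2 d
_⋆_ {d} l X = scal (fromℤ d l) X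

⋆≡•M : ∀ {d} l (X : M2 d) → l ⋆ X ≡ l •M X
⋆≡•M {d} l X = mat-cong (fromℤ-*R d l _) (fromℤ-*R d l _) (fromℤ-*R d l _) (fromℤ-*R d l _)

⋆-·M : ∀ {d} l m (X Y : M2 d) → (l ⋆ X) ·M (m ⋆ Y) ≡ (l ℤ.* m) ⋆ (X ·M Y)
⋆-·M l m X Y = begin
  (l ⋆ X) ·M (m ⋆ Y)     ≡⟨ cong₂ _·M_ (⋆≡•M l X) (⋆≡•M m Y) ⟩
  (l •M X) ·M (m •M Y)   ≡⟨ •M-·M l m X Y ⟩
  (l ℤ.* m) •M (X ·M Y)  ≡⟨ ⋆≡•M (l ℤ.* m) (X ·M Y) ⟨
  (l ℤ.* m) ⋆ (X ·M Y)   ∎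
  where open ≡-Reasoning

⋆-0M : ∀ {d} l → l ⋆ 0M {d} ≡ 0M
⋆-0M l = trans (⋆≡•M l 0M) (mat-cong (•-0R l) (•-0R l) (•-0R l) (•-0R l))

⋆-cancelˡ : ∀ {d} l .{{_ : ℤ.NonZero l}} {X Y : M2 d} → l ⋆ X ≡ l ⋆ Y → X ≡ Y
⋆-cancelˡ l {X} {Y} e = •M-cancelˡ l (trans (sym (⋆≡•M l X)) (trans e (⋆≡•M l Y)))

·M-⋆-annihilates⁺ : ∀ {d} l m {X Y : M2 d} → X ·M Y ≡ 0M → (l ⋆ X) ·M (m ⋆ Y) ≡ 0M
·M-⋆-annihilates⁺ l m {X} {Y} XY≡0 = trans (⋆-·M l m X Y) (trans (cong ((l ℤ.* m) ⋆_) XY≡0) (⋆-0M _))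

·M-⋆-annihilates⁻ : ∀ {d} l m .{{_ : ℤ.NonZero l}} .{{_ : ℤ.NonZero m}} {X Y : M2 d} →
                    (l ⋆ X) ·M (m ⋆ Y) ≡ 0M → X ·M Y ≡ 0M
·M-⋆-annihilates⁻ l m {X} {Y} e =
  ⋆-cancelˡ (l ℤ.* m) {{ℤP.i*j≢0 l m}} (trans (sym (⋆-·M l m X Y)) (trans e (sym (⋆-0M _))))

AdjUn-⋆⁺ : ∀ {d} l m {X Y : M2 d} → AdjUn X Y → AdjUn (l ⋆ X) (m ⋆ Y)
AdjUn-⋆⁺ l m = Sum.map (·M-⋆-annihilates⁺ l m) (·M-⋆-annihilates⁺ m l)

AdjUn-⋆⁻ : ∀ {d} l m .{{_ : ℤ.NonZero l}} .{{_ : ℤ.NonZero m}} {X Y : M2 d} →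
           AdjUn (l ⋆ X) (m ⋆ Y) → AdjUn X Y
AdjUn-⋆⁻ l m = Sum.map (·M-⋆-annihilates⁻ l m) (·M-⋆-annihilates⁻ m l)

module ZeroDivisorGraph (d : ℕ) where
  open Graph (AdjUn {d}) public

  -- S_{tc,1,t,N} and S_{tc,2,N} are the classes of B t and E₂₂ below.
  B : R d → M2 d
  B t = mat 1R t (t *R t) (t *R t *R t)

  E₂₂ : M2 d
  E₂₂ = mat 0R 0R 0R 1R

  one -one i -i ω -ω ω² -ω² : R d
  one = 1R
  -one = -R one
  i = ιR d
  -i = -R i
  ω = ωR d
  -ω = -R ω
  ω² = ω *R ω
  -ω² = -R ω²

  Class : ℕ → M2 d → Pred (M2 d) 0ℓ
  Class N X = Range (_⋆ X) N

  InS2≐Class : ∀ {N} → InS2 d N ≐ Class N E₂₂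
  InS2≐Class = Range-cong λ l → sym (trans (⋆≡•M l E₂₂) (mat-cong (•-0R l) (•-0R l) (•-0R l) (•-1R l)))

  ⋆-nonadjacent : ∀ {X Y : M2 d} {l m} → ¬ AdjUn X Y → 1 ≤ ∣ l ∣ → 1 ≤ ∣ m ∣ → ¬ AdjUn (l ⋆ X) (m ⋆ Y)
  ⋆-nonadjacent {X} {Y} {l} {m} ¬XY 1≤l 1≤m =
    ¬XY ∘ AdjUn-⋆⁻ l m {{ℕ.>-nonZero 1≤l}} {{ℕ.>-nonZero 1≤m}} {X} {Y}

  classes-anticomplete : ∀ {N} (X Y : M2 d) → ¬ AdjUn X Y → Anticomplete (Class N X) (Class N Y)
  classes-anticomplete _ _ ¬XY _ _ (_ , 1≤l , _ , refl) (_ , 1≤m , _ , refl) =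
    ⋆-nonadjacent ¬XY 1≤l 1≤m , ⋆-nonadjacent (¬XY ∘ Sum.swap) 1≤m 1≤l

  classes-complete : ∀ {N} (X Y : M2 d) → (∀ {l m} → 1 ≤ ∣ l ∣ → l ⋆ X ≢ m ⋆ Y) → AdjUn X Y →
                     Complete (Class N X) (Class N Y)
  classes-complete _ _ distinct XY _ _ (l , 1≤l , _ , refl) (m , _ , _ , refl) =
    distinct {l} {m} 1≤l , AdjUn-⋆⁺ l m XY , AdjUn-⋆⁺ m l (Sum.swap XY)

  certified-class-edgeless : ∀ (X : M2 d) → ¬ AdjUn X X → ∀ N → Certified (Class N X)
  certified-class-edgeless _ ¬XX = certified-range-edgeless (⋆-nonadjacent ¬XX)

  certified-class-complete : ∀ (X : M2 d) → Injective _≡_ _≡_ (_⋆ X) → AdjUn X X →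
                             ∀ N → Certified (Class N X)
  certified-class-complete _ ⋆X-injective XX =
    certified-range-complete ⋆X-injective (λ {l} {m} _ _ → AdjUn-⋆⁺ l m XX)

  ⋆B-multiplier : ∀ {t s : R d} {l m} → l ⋆ B t ≡ m ⋆ B s → l ≡ m
  ⋆B-multiplier {l = l} {m} e =
    •-1R-injective (trans (sym (fromℤ-*R d l 1R)) (trans (cong m11 e) (fromℤ-*R d m 1R)))

  ⋆B-injective : ∀ t → Injective _≡_ _≡_ (_⋆ B t)
  ⋆B-injective t = ⋆B-multiplier

  -- Once the (1,1) entries force l ≡ m, the (1,2) entries give l • t ≡ l • s.
  ⋆B-distinct : ∀ {t s : R d} {l m} → t ≢ s → 1 ≤ ∣ l ∣ → l ⋆ B t ≢ m ⋆ B s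
  ⋆B-distinct {t} {s} {l} t≢s 1≤l e with ⋆B-multiplier e
  ... | refl = t≢s (•-cancelˡ l {{ℕ.>-nonZero 1≤l}}
                     (trans (sym (fromℤ-*R d l t)) (trans (cong m12 e) (fromℤ-*R d l s))))

  classes-B-complete : ∀ {N} t s → t ≢ s → AdjUn (B t) (B s) → Complete (Class N (B t)) (Class N (B s))
  classes-B-complete t s t≢s = classes-complete (B t) (B s) (⋆B-distinct t≢s)

  ⋆B₀-⋆E₂₂-distinct : ∀ {l m} → 1 ≤ ∣ l ∣ → l ⋆ B 0R ≢ m ⋆ E₂₂
  ⋆B₀-⋆E₂₂-distinct {l} {m} 1≤l e = ℕP.<⇒≢ 1≤l (sym (cong ∣_∣ l≡0))
    where
    l≡0 : l ≡ + 0
    l≡0 = fromℤ-injective d (begin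
      fromℤ d l          ≡⟨ •-1R l ⟨
      l • 1R             ≡⟨ fromℤ-*R d l 1R ⟨
      m11 (l ⋆ B 0R)     ≡⟨ cong m11 e ⟩
      m11 (m ⋆ E₂₂)      ≡⟨ fromℤ-*R d m 0R ⟩
      m • 0R             ≡⟨ •-0R m ⟩
      fromℤ d (+ 0)      ∎)
      where open ≡-Reasoning

  Γ₁-perfect : ¬ AdjUn (B 0R) (B 0R) → ¬ AdjUn E₂₂ E₂₂ → AdjUn (B 0R) E₂₂ →
               ∀ N → Perfect (VertΓ1 d N) (AdjUn {d})
  Γ₁-perfect ¬B₀B₀ ¬E₂₂E₂₂ B₀E₂₂ N =
    certified⇒perfect (certified-≐ (Sum.map₂ (proj₂ InS2≐Class) , Sum.map₂ (proj₁ InS2≐Class))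
      (certified-join (classes-complete (B 0R) E₂₂ ⋆B₀-⋆E₂₂-distinct B₀E₂₂)
        (certified-class-edgeless (B 0R) ¬B₀B₀ N) (certified-class-edgeless E₂₂ ¬E₂₂E₂₂ N)))

  Pair : ℕ → R d → Pred (M2 d) 0ℓ
  Pair N u = Class N (B u) ∪ Class N (B (-R u))

  certified-Pair : ∀ u → u ≢ -R u →
                   ¬ AdjUn (B u) (B u) → AdjUn (B (-R u)) (B (-R u)) → AdjUn (B u) (B (-R u)) →
                   ∀ N → Certified (Pair N u)
  certified-Pair u u≢-u ¬uu -u-u u-u N =
    certified-join (classes-B-complete u (-R u) u≢-u u-u)
      (certified-class-edgeless (B u) ¬uu N) (certified-class-complete (B (-R u)) (⋆B-injective _) -u-u N)

  Pairs-anticomplete : ∀ {N} u v → ¬ AdjUn (B u) (B v) → ¬ AdjUn (B u) (B (-R v)) →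
                       ¬ AdjUn (B (-R u)) (B v) → ¬ AdjUn (B (-R u)) (B (-R v)) →
                       Anticomplete (Pair N u) (Pair N v)
  Pairs-anticomplete u v ¬uv ¬u-v ¬-uv ¬-u-v =
    anticomplete-∪ˡ (anticomplete-∪ʳ (classes-anticomplete _ _ ¬uv) (classes-anticomplete _ _ ¬u-v))
                    (anticomplete-∪ʳ (classes-anticomplete _ _ ¬-uv) (classes-anticomplete _ _ ¬-u-v))

  Γ₂-perfect-±1 : d ≢ 1 → d ≢ 3 → one ≢ -one → ¬ AdjUn (B one) (B one) → AdjUn (B -one) (B -one) →
                  AdjUn (B one) (B -one) → ∀ N → Perfect (VertΓ2 d N) (AdjUn {d})
  Γ₂-perfect-±1 d≢1 d≢3 1≢-1 ¬11 -1-1 1-1 N =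
    certified⇒perfect (certified-≐ (units , ±1) (certified-Pair one 1≢-1 ¬11 -1-1 1-1 N))
    where
    units : Pair N one ⊆ VertΓ2 d N
    units (inj₁ x) = one , inj₁ refl , x
    units (inj₂ x) = -one , inj₂ (inj₁ refl) , x
    ±1 : VertΓ2 d N ⊆ Pair N one
    ±1 (_ , inj₁ refl , x) = inj₁ x
    ±1 (_ , inj₂ (inj₁ refl) , x) = inj₂ x
    ±1 (_ , inj₂ (inj₂ (inj₁ (d≡1 , _))) , _) = ⊥-elim (d≢1 d≡1)
    ±1 (_ , inj₂ (inj₂ (inj₂ (d≡3 , _))) , _) = ⊥-elim (d≢3 d≡3)

-- B t ·M B s = (1 + t s²) · [1 s ; t² t² s], so B t and B s are adjacent iff 1 + t s² = 0 or 1 + s t² = 0.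
-- The adjacencies between generators below are decided by evaluating these products.

Γ₁-perfect : ∀ d N → Perfect (VertΓ1 d N) (AdjUn {d})
Γ₁-perfect zero    = ZeroDivisorGraph.Γ₁-perfect 0       (λ { (inj₁ ()) ; (inj₂ ()) }) (λ { (inj₁ ()) ; (inj₂ ()) })
                                                           (inj₁ refl)
Γ₁-perfect (suc k) = ZeroDivisorGraph.Γ₁-perfect (suc k) (λ { (inj₁ ()) ; (inj₂ ()) }) (λ { (inj₁ ()) ; (inj₂ ()) })
                                                           (inj₁ refl)

Γ₂-perfect-suc : ∀ k → suc k ≢ 1 → suc k ≢ 3 → ∀ N → Perfect (VertΓ2 (suc k) N) (AdjUn {suc k})
Γ₂-perfect-suc k d≢1 d≢3 =
  ZeroDivisorGraph.Γ₂-perfect-±1 (suc k) d≢1 d≢3 (λ ()) (λ { (inj₁ ()) ; (inj₂ ()) }) (inj₁ refl) (inj₂ refl)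

Γ₂-perfect-i : ∀ N → Perfect (VertΓ2 1 N) (AdjUn {1})
Γ₂-perfect-i N =
  certified⇒perfect (certified-≐ (units , classes)
    (certified-join
      (complete-∪ʳ (classes-B-complete one -one (λ ()) (inj₂ refl))
        (complete-∪ʳ (classes-B-complete one i (λ ()) (inj₁ refl))
                     (classes-B-complete one -i (λ ()) (inj₁ refl))))
      (certified-class-edgeless (B one) (λ { (inj₁ ()) ; (inj₂ ()) }) N)
      (certified-∪
        (anticomplete-∪ʳ (classes-anticomplete (B -one) (B i) (λ { (inj₁ ()) ; (inj₂ ()) }))
                         (classes-anticomplete (B -one) (B -i) (λ { (inj₁ ()) ; (inj₂ ()) })))
        (certified-class-complete (B -one) (⋆B-injective _) (inj₁ refl) N)
        (certified-∪ (classes-anticomplete (B i) (B -i) (λ { (inj₁ ()) ; (inj₂ ()) }))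
          (certified-class-edgeless (B i) (λ { (inj₁ ()) ; (inj₂ ()) }) N)
          (certified-class-edgeless (B -i) (λ { (inj₁ ()) ; (inj₂ ()) }) N)))))
  where
  open ZeroDivisorGraph 1
  Classes : Pred (M2 1) 0ℓ
  Classes = Class N (B one) ∪ (Class N (B -one) ∪ (Class N (B i) ∪ Class N (B -i)))
  units : Classes ⊆ VertΓ2 1 N
  units (inj₁ x)               = _ , inj₁ refl , x
  units (inj₂ (inj₁ x))        = _ , inj₂ (inj₁ refl) , x
  units (inj₂ (inj₂ (inj₁ x))) = _ , inj₂ (inj₂ (inj₁ (refl , inj₁ refl))) , x
  units (inj₂ (inj₂ (inj₂ x))) = _ , inj₂ (inj₂ (inj₁ (refl , inj₂ refl))) , x
  classes : VertΓ2 1 N ⊆ Classes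
  classes (_ , inj₁ refl , x)                          = inj₁ x
  classes (_ , inj₂ (inj₁ refl) , x)                   = inj₂ (inj₁ x)
  classes (_ , inj₂ (inj₂ (inj₁ (_ , inj₁ refl))) , x) = inj₂ (inj₂ (inj₁ x))
  classes (_ , inj₂ (inj₂ (inj₁ (_ , inj₂ refl))) , x) = inj₂ (inj₂ (inj₂ x))
  classes (_ , inj₂ (inj₂ (inj₂ (() , _))) , _)

Γ₂-perfect-ω : ∀ N → Perfect (VertΓ2 3 N) (AdjUn {3})
Γ₂-perfect-ω N =
  certified⇒perfect (certified-≐ (units , pairs)
    (certified-∪
      (anticomplete-∪ʳ
        (Pairs-anticomplete one ω (λ { (inj₁ ()) ; (inj₂ ()) }) (λ { (inj₁ ()) ; (inj₂ ()) })
                                  (λ { (inj₁ ()) ; (inj₂ ()) }) (λ { (inj₁ ()) ; (inj₂ ()) }))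
        (Pairs-anticomplete one ω² (λ { (inj₁ ()) ; (inj₂ ()) }) (λ { (inj₁ ()) ; (inj₂ ()) })
                                   (λ { (inj₁ ()) ; (inj₂ ()) }) (λ { (inj₁ ()) ; (inj₂ ()) })))
      (certified-Pair one (λ ()) (λ { (inj₁ ()) ; (inj₂ ()) }) (inj₁ refl) (inj₂ refl) N)
      (certified-∪ (Pairs-anticomplete ω ω² (λ { (inj₁ ()) ; (inj₂ ()) }) (λ { (inj₁ ()) ; (inj₂ ()) })
                                          (λ { (inj₁ ()) ; (inj₂ ()) }) (λ { (inj₁ ()) ; (inj₂ ()) }))
        (certified-Pair ω (λ ()) (λ { (inj₁ ()) ; (inj₂ ()) }) (inj₁ refl) (inj₂ refl) N)
        (certified-Pair ω² (λ ()) (λ { (inj₁ ()) ; (inj₂ ()) }) (inj₁ refl) (inj₂ refl) N))))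
  where
  open ZeroDivisorGraph 3
  Pairs : Pred (M2 3) 0ℓ
  Pairs = Pair N one ∪ (Pair N ω ∪ Pair N ω²)
  units : Pairs ⊆ VertΓ2 3 N
  units (inj₁ (inj₁ x))        = _ , inj₁ refl , x
  units (inj₁ (inj₂ x))        = _ , inj₂ (inj₁ refl) , x
  units (inj₂ (inj₁ (inj₁ x))) = _ , inj₂ (inj₂ (inj₂ (refl , inj₁ refl))) , x
  units (inj₂ (inj₁ (inj₂ x))) = _ , inj₂ (inj₂ (inj₂ (refl , inj₂ (inj₁ refl)))) , x
  units (inj₂ (inj₂ (inj₁ x))) = _ , inj₂ (inj₂ (inj₂ (refl , inj₂ (inj₂ (inj₁ refl))))) , x
  units (inj₂ (inj₂ (inj₂ x))) = _ , inj₂ (inj₂ (inj₂ (refl , inj₂ (inj₂ (inj₂ refl))))) , x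
  pairs : VertΓ2 3 N ⊆ Pairs
  pairs (_ , inj₁ refl , x)                                           = inj₁ (inj₁ x)
  pairs (_ , inj₂ (inj₁ refl) , x)                                    = inj₁ (inj₂ x)
  pairs (_ , inj₂ (inj₂ (inj₁ (() , _))) , _)
  pairs (_ , inj₂ (inj₂ (inj₂ (_ , inj₁ refl))) , x)                  = inj₂ (inj₁ (inj₁ x))
  pairs (_ , inj₂ (inj₂ (inj₂ (_ , inj₂ (inj₁ refl)))) , x)           = inj₂ (inj₁ (inj₂ x))
  pairs (_ , inj₂ (inj₂ (inj₂ (_ , inj₂ (inj₂ (inj₁ refl))))) , x)    = inj₂ (inj₂ (inj₁ x))
  pairs (_ , inj₂ (inj₂ (inj₂ (_ , inj₂ (inj₂ (inj₂ refl))))) , x)    = inj₂ (inj₂ (inj₂ x))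

Γ₂-perfect : ∀ d N → Perfect (VertΓ2 d N) (AdjUn {d})
Γ₂-perfect zero =
  ZeroDivisorGraph.Γ₂-perfect-±1 0 (λ ()) (λ ()) (λ ()) (λ { (inj₁ ()) ; (inj₂ ()) }) (inj₁ refl) (inj₂ refl)
Γ₂-perfect 1                         = Γ₂-perfect-i
Γ₂-perfect 2                         = Γ₂-perfect-suc 1 (λ ()) (λ ())
Γ₂-perfect 3                         = Γ₂-perfect-ω
Γ₂-perfect (suc (suc (suc (suc k)))) = Γ₂-perfect-suc (3 + k) (λ ()) (λ ())

corollary3p20 : (d : ℕ) → (d ≡ 0 ⊎ (0 < d × SquareFree d)) → (n : ℕ) → 1 ≤ n →
    Perfect (VertΓ1 d n) (AdjUn {d}) × Perfect (VertΓ2 d n) (AdjUn {d})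
corollary3p20 d _ n _ = Γ₁-perfect d n , Γ₂-perfect d n
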